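{- Let $G$ and $H$ be finite simple graphs, let $\mathscr{C}$ be a clique cover of $G$ with $|\mathscr{C}|=q$, and let $U\subseteq V(H)$. Then the polynomial $I^{q-\alpha(G)}(H;x)$ divides $I(G^{\mathscr{C}}\star H^U;x)$.
   Context: For a finite simple graph $G$, $i_k(G)$ is the number of independent sets of size $k$ ($i_0(G)=1$), $\alpha(G)$ is the maximum size of an independent set, and $I(G;x)=\sum_{k=0}^{\alpha(G)} i_k(G)x^k$ is the independence polynomial. A clique cover of $G$ is a spanning subgraph each of whose components is a clique; we view it as the set $\mathscr{C}$ of these cliques, which partition $V(G)$. The clique cover product $G^{\mathscr{C}}\star H^U$ is obtained from $G$ by, for each clique $C\in\mathscr{C}$, adding a new disjoint copy of $H$ and joining every vertex of $C$ to every vertex of the copy of $U$ in that copy of $H$. $I^m(H;x)$ denotes $(I(H;x))^m$. -}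

module Defs where

open import Data.Bool using (Bool; true; false; _∧_; not; if_then_else_)
open import Data.Nat as ℕ using (ℕ; zero; suc; _∸_; _≡ᵇ_)
open import Data.Fin using (Fin; splitAt; remQuot)
open import Data.Fin.Properties using (_≟_)
open import Data.Fin.Subset using (Subset; ∣_∣)
open import Data.Integer as ℤ using (ℤ; +_)
open import Data.List using (List; []; _∷_; length; filter; map; allFin; upTo; foldr)
open import Data.Vec using (Vec; []; _∷_; lookup)
open import Data.Bool.ListAction using (all)
open import Data.Sum using (_⊎_; inj₁; inj₂)
open import Data.Product using (_×_; _,_; Σ; ∃)
open import Relation.Nullary.Decidable using (⌊_⌋)
open import Relation.Binary.PropositionalEquality using (_≡_; _≢_)

record Graph : Set where
  field
    order : ℕ
    adj   : Fin order → Fin order → Bool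
open Graph public

IsSimple : Graph → Set
IsSimple G = (∀ u v → adj G u v ≡ adj G v u) × (∀ v → adj G v v ≡ false)

allSubsets : (n : ℕ) → List (Subset n)
allSubsets zero    = [] ∷ []
allSubsets (suc n) = map (true ∷_) (allSubsets n) Data.List.++ map (false ∷_) (allSubsets n)
  where import Data.List

isIndependent : (G : Graph) → Subset (order G) → Bool
isIndependent G S =
  all (λ u → all (λ v → not (lookup S u ∧ lookup S v ∧ adj G u v)) (allFin _)) (allFin _)

indepCount : Graph → ℕ → ℕ
indepCount G k =
  length (filter (λ S → Data.Bool._≟_ (isIndependent G S ∧ (∣ S ∣ ≡ᵇ k)) true) (allSubsets (order G)))
  where import Data.Bool

alpha : Graph → ℕ
alpha G = foldr (λ S m → if isIndependent G S then ℕ._⊔_ ∣ S ∣ m else m) 0 (allSubsets (order G))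

-- Polynomials with integer coefficients as coefficient lists (degree 0 first)

Poly : Set
Poly = List ℤ

coeff : Poly → ℕ → ℤ
coeff []       _       = + 0
coeff (a ∷ p)  zero    = a
coeff (a ∷ p)  (suc k) = coeff p k

_+ₚ_ : Poly → Poly → Poly
[]      +ₚ q       = q
p       +ₚ []      = p
(a ∷ p) +ₚ (b ∷ q) = (a ℤ.+ b) ∷ (p +ₚ q)

_*ₚ_ : Poly → Poly → Poly
[]      *ₚ q = []
(a ∷ p) *ₚ q = map (a ℤ.*_) q +ₚ (+ 0 ∷ (p *ₚ q))

_^ₚ_ : Poly → ℕ → Poly
p ^ₚ zero  = + 1 ∷ []
p ^ₚ suc m = p *ₚ (p ^ₚ m)

-- divisibility in ℤ[x] (equality of polynomials = equality of all coefficients)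
_∣ₚ_ : Poly → Poly → Set
P ∣ₚ R = Σ Poly λ Q → ∀ k → coeff (P *ₚ Q) k ≡ coeff R k

indepPoly : Graph → Poly
indepPoly G = map (λ k → + indepCount G k) (upTo (suc (order G)))

-- Clique covers, given as an assignment of each vertex to one of q cliques.

record CliqueCover (G : Graph) (q : ℕ) : Set where
  field
    cls       : Fin (order G) → Fin q
    nonempty  : ∀ i → ∃ λ v → cls v ≡ i
    isClique  : ∀ u v → cls u ≡ cls v → u ≢ v → adj G u v ≡ true
open CliqueCover public

-- Clique cover product G^𝒞 ⋆ H^U.
-- Vertices: Fin (n + q * m): first the n vertices of G, then the q copies of H,
-- the vertex (i , a) being vertex a of the copy of H attached to clique i.

starAdj : (G : Graph) {q : ℕ} → CliqueCover G q → (H : Graph) → Subset (order H) →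
          (Fin (order G) ⊎ (Fin q × Fin (order H))) →
          (Fin (order G) ⊎ (Fin q × Fin (order H))) → Bool
starAdj G C H U (inj₁ u)       (inj₁ v)       = adj G u v
starAdj G C H U (inj₂ (i , a)) (inj₂ (j , b)) = ⌊ i ≟ j ⌋ ∧ adj H a b
starAdj G C H U (inj₁ u)       (inj₂ (i , a)) = ⌊ cls C u ≟ i ⌋ ∧ lookup U a
starAdj G C H U (inj₂ (i , a)) (inj₁ u)       = ⌊ cls C u ≟ i ⌋ ∧ lookup U a

decode : (n q m : ℕ) → Fin (n ℕ.+ q ℕ.* m) → Fin n ⊎ (Fin q × Fin m)
decode n q m x with splitAt n x
... | inj₁ u = inj₁ u
... | inj₂ y = inj₂ (remQuot m y)

cliqueCoverProduct : (G : Graph) {q : ℕ} → CliqueCover G q → (H : Graph) → Subset (order H) → Graph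
cliqueCoverProduct G {q} C H U = record
  { order = order G ℕ.+ q ℕ.* order H
  ; adj   = λ x y → starAdj G C H U (decode (order G) q (order H) x) (decode (order G) q (order H) y)
  }

module Submission where

open import Defs
open import Level using (0ℓ)
open import Function using (_∘_; mk⇔)
open import Data.Nat as ℕ using (ℕ; zero; suc; _∸_; _≤_; z≤n; s≤s; _⊔_; _≡ᵇ_)
import Data.Nat.Properties as ℕP
open import Data.Integer using (ℤ; +_; _+_; _*_)
import Data.Integer.Properties as ℤP
open import Data.Integer.Tactic.RingSolver using (solve-∀)
open import Data.Bool as Bool using (Bool; true; false; _∧_; _∨_; not; if_then_else_; T)
open import Data.Bool.Properties using (⇔→≡; ∧-zeroʳ; ∧-assoc; ∧-identityʳ; ∧-conicalˡ; ∧-conicalʳ; ∧-commutativeMonoid)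
open import Data.Bool.ListAction using (all)
open import Data.List as List using (List; []; _∷_; map; foldr; tabulate; length; filter; applyUpTo)
open import Data.List.Properties using (filter-none)
open import Data.List.Relation.Unary.All using (universal)
open import Data.List.Relation.Unary.Any using (here; there)
open import Data.List.Membership.Propositional using (_∈_)
open import Data.List.Membership.Propositional.Properties using (∈-++⁺ˡ; ∈-++⁺ʳ; ∈-map⁺)
open import Data.Vec using (Vec; []; _∷_; _++_; lookup; take; drop)
open import Data.Vec.Properties using (lookup-splitAt; take++drop≡id)
open import Data.Fin using (Fin; zero; suc; splitAt; remQuot; combine; _↑ˡ_; _↑ʳ_)
open import Data.Fin.Properties using (_≟_; splitAt-↑ˡ; splitAt-↑ʳ; remQuot-combine)
open import Data.Fin.Subset using (Subset; ∣_∣)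
open import Data.Fin.Subset.Properties using (∣p∣≤n)
open import Data.Product using (_×_; _,_; proj₁; proj₂)
open import Data.Sum using (_⊎_; inj₁; inj₂; [_,_]′)
open import Relation.Nullary.Decidable using (⌊_⌋; yes; no; dec-true; isYes≗does)
open import Relation.Binary.PropositionalEquality as ≡ using (_≡_; _≢_; refl; cong; cong₂)
open import Relation.Binary.Structures using (IsEquivalence)
open import Algebra.Bundles using (CommutativeMonoid; CommutativeSemiring)
open import Algebra.Structures using (IsCommutativeMonoid)
open import Algebra.Structures.Biased using (isCommutativeSemiringˡ)
import Algebra.Properties.CommutativeSemigroup as CommutativeSemigroupProperties
import Algebra.Properties.Monoid.Sum as MonoidSum
import Relation.Binary.Reasoning.Setoid as SetoidReasoning

-- An independent set of P = G^𝒞 ⋆ H^U is a set A ⊆ V(G) independent in G together with, for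
-- each clique i of 𝒞, a set Bᵢ independent in the i-th copy of H, where Bᵢ must avoid U as soon
-- as A meets clique i.  Summing x^|S| over these sets gives the expansion
--   I(P) = Σ_{A indep. in G} x^|A| · I(H)^(#cliques A avoids) · I(H − U)^(#cliques A meets).
-- A set A meets at most |A| classes of the partition 𝒞, and |A| ≤ α(G) for A independent, so
-- A avoids at least q − α(G) cliques and every term is a multiple of I(H)^(q − α(G)).

∀ᵇ : ∀ n → (Fin n → Bool) → Bool
∀ᵇ zero    f = true
∀ᵇ (suc n) f = f zero ∧ ∀ᵇ n (f ∘ suc)

∀ᵇ-cong : ∀ n {f g : Fin n → Bool} → (∀ i → f i ≡ g i) → ∀ᵇ n f ≡ ∀ᵇ n g
∀ᵇ-cong zero    f≗g = refl
∀ᵇ-cong (suc n) f≗g = cong₂ _∧_ (f≗g zero) (∀ᵇ-cong n (f≗g ∘ suc))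

∀ᵇ-sound : ∀ n {f} → ∀ᵇ n f ≡ true → ∀ i → f i ≡ true
∀ᵇ-sound (suc n)     holds zero    = ∧-conicalˡ _ _ holds
∀ᵇ-sound (suc n) {f} holds (suc i) = ∀ᵇ-sound n (∧-conicalʳ (f zero) _ holds) i

∀ᵇ-complete : ∀ n {f} → (∀ i → f i ≡ true) → ∀ᵇ n f ≡ true
∀ᵇ-complete zero    holds = refl
∀ᵇ-complete (suc n) holds rewrite holds zero = ∀ᵇ-complete n (holds ∘ suc)

∀ᵇ-split : ∀ n m (f : Fin n → Bool) (g : Fin m → Bool) →
  ∀ᵇ n (λ u → ∀ᵇ m (λ a → not (f u ∧ g a))) ≡ (∀ᵇ n (not ∘ f) ∨ ∀ᵇ m (not ∘ g))
∀ᵇ-split zero    m f g = refl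
∀ᵇ-split (suc n) m f g with f zero
... | true  rewrite ∀ᵇ-split n m (f ∘ suc) g = absorb (∀ᵇ m (not ∘ g)) (∀ᵇ n (not ∘ f ∘ suc))
  where
  absorb : ∀ x y → x ∧ (y ∨ x) ≡ x
  absorb false y     = refl
  absorb true  false = refl
  absorb true  true  = refl
... | false rewrite ∀ᵇ-complete m {λ _ → true} (λ _ → refl) = ∀ᵇ-split n m (f ∘ suc) g

isIndependent-∀ᵇ : ∀ G S →
  isIndependent G S ≡ ∀ᵇ (order G) (λ u → ∀ᵇ (order G) (λ v → not (lookup S u ∧ lookup S v ∧ adj G u v)))
isIndependent-∀ᵇ G S =
  ≡.trans (all-tabulate {n = order G} _ (λ i → i)) (∀ᵇ-cong (order G) (λ u → all-tabulate {n = order G} _ (λ i → i)))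
  where
  all-tabulate : ∀ {X : Set} {n} (p : X → Bool) (f : Fin n → X) → all p (tabulate f) ≡ ∀ᵇ n (p ∘ f)
  all-tabulate {n = zero}  p f = refl
  all-tabulate {n = suc n} p f = cong (p (f zero) ∧_) (all-tabulate p (f ∘ suc))

isIndependent-sound : ∀ G S → isIndependent G S ≡ true →
  ∀ u v → not (lookup S u ∧ lookup S v ∧ adj G u v) ≡ true
isIndependent-sound G S indep u v =
  ∀ᵇ-sound (order G) (∀ᵇ-sound (order G) (≡.trans (≡.sym (isIndependent-∀ᵇ G S)) indep) u) v

isIndependent-complete : ∀ G S → (∀ u v → not (lookup S u ∧ lookup S v ∧ adj G u v) ≡ true) →
  isIndependent G S ≡ true
isIndependent-complete G S noEdge =
  ≡.trans (isIndependent-∀ᵇ G S) (∀ᵇ-complete (order G) (λ u → ∀ᵇ-complete (order G) (noEdge u)))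

alpha-bound : ∀ G (A : Subset (order G)) → isIndependent G A ≡ true → ∣ A ∣ ≤ alpha G
alpha-bound G A indep = foldr-bound (allSubsets (order G)) (allSubsets-complete (order G) A)
  where
  P : Subset (order G) → Bool
  P = isIndependent G
  foldr-bound : ∀ Ls → A ∈ Ls → ∣ A ∣ ≤ foldr (λ S m → if P S then ∣ S ∣ ⊔ m else m) 0 Ls
  foldr-bound (S ∷ Ls) (here refl) rewrite indep = ℕP.m≤m⊔n _ _
  foldr-bound (S ∷ Ls) (there A∈Ls) with P S
  ... | true  = ℕP.m≤n⇒m≤o⊔n ∣ S ∣ (foldr-bound Ls A∈Ls)
  ... | false = foldr-bound Ls A∈Ls
  allSubsets-complete : ∀ n (A : Subset n) → A ∈ allSubsets n
  allSubsets-complete zero    []          = here refl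
  allSubsets-complete (suc n) (true ∷ A)  = ∈-++⁺ˡ (∈-map⁺ (true ∷_) (allSubsets-complete n A))
  allSubsets-complete (suc n) (false ∷ A) =
    ∈-++⁺ʳ (map (true ∷_) (allSubsets n)) (∈-map⁺ (false ∷_) (allSubsets-complete n A))

trues : ∀ q → (Fin q → Bool) → ℕ
trues zero    f = 0
trues (suc q) f = if f zero then suc (trues q (f ∘ suc)) else trues q (f ∘ suc)

trues-not : ∀ q f → trues q f ℕ.+ trues q (not ∘ f) ≡ q
trues-not zero    f = refl
trues-not (suc q) f with f zero
... | true  = cong suc (trues-not q (f ∘ suc))
... | false = ≡.trans (ℕP.+-suc _ _) (cong suc (trues-not q (f ∘ suc)))

trues-cong : ∀ q {f g : Fin q → Bool} → (∀ i → f i ≡ g i) → trues q f ≡ trues q g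
trues-cong zero    f≗g = refl
trues-cong (suc q) f≗g rewrite f≗g zero | trues-cong q (f≗g ∘ suc) = refl

trues-false : ∀ q → trues q (λ _ → false) ≡ 0
trues-false zero    = refl
trues-false (suc q) = trues-false q

trues-∨ : ∀ q f g → trues q (λ i → f i ∨ g i) ≤ trues q f ℕ.+ trues q g
trues-∨ zero    f g = z≤n
trues-∨ (suc q) f g with f zero | g zero
... | true  | true  = s≤s (ℕP.≤-trans (trues-∨ q (f ∘ suc) (g ∘ suc)) (ℕP.+-monoʳ-≤ _ (ℕP.n≤1+n _)))
... | true  | false = s≤s (trues-∨ q (f ∘ suc) (g ∘ suc))
... | false | true  = ℕP.≤-trans (s≤s (trues-∨ q (f ∘ suc) (g ∘ suc))) (ℕP.≤-reflexive (≡.sym (ℕP.+-suc _ _)))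
... | false | false = trues-∨ q (f ∘ suc) (g ∘ suc)

trues-≟ : ∀ q (c : Fin q) → trues q (λ i → ⌊ c ≟ i ⌋) ≤ 1
trues-≟ (suc q) zero    = s≤s (ℕP.≤-reflexive (trues-false q))
trues-≟ (suc q) (suc c) = ℕP.≤-trans (ℕP.≤-reflexive (trues-cong q ≟-suc)) (trues-≟ q c)
  where
  ≟-suc : ∀ i → ⌊ suc c ≟ suc i ⌋ ≡ ⌊ c ≟ i ⌋
  ≟-suc i with c ≟ i
  ... | yes _ = refl
  ... | no  _ = refl

avoids : ∀ {n q} → (Fin n → Fin q) → Fin q → Subset n → Bool
avoids {n} cls i A = ∀ᵇ n (λ u → not (lookup A u ∧ ⌊ cls u ≟ i ⌋))

classes-met-bound : ∀ n q (cls : Fin n → Fin q) (A : Subset n) → trues q (λ i → not (avoids cls i A)) ≤ ∣ A ∣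
classes-met-bound zero    q cls []      = ℕP.≤-reflexive (trues-false q)
classes-met-bound (suc n) q cls (b ∷ A) = begin
  trues q (λ i → not (avoids cls i (b ∷ A)))
    ≡⟨ trues-cong q (λ i → not-∧-not (b ∧ ⌊ cls zero ≟ i ⌋) (avoids (cls ∘ suc) i A)) ⟩
  trues q (λ i → (b ∧ ⌊ cls zero ≟ i ⌋) ∨ not (avoids (cls ∘ suc) i A))
    ≤⟨ trues-∨ q _ _ ⟩
  trues q (λ i → b ∧ ⌊ cls zero ≟ i ⌋) ℕ.+ trues q (λ i → not (avoids (cls ∘ suc) i A))
    ≤⟨ ℕP.+-mono-≤ (first b) (classes-met-bound n q (cls ∘ suc) A) ⟩
  (if b then 1 else 0) ℕ.+ ∣ A ∣
    ≡⟨ size-∷ b A ⟩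
  ∣ b ∷ A ∣ ∎
  where
  open ℕP.≤-Reasoning
  first : ∀ b → trues q (λ i → b ∧ ⌊ cls zero ≟ i ⌋) ≤ (if b then 1 else 0)
  first true  = trues-≟ q (cls zero)
  first false = ℕP.≤-reflexive (trues-false q)

  not-∧-not : ∀ x y → not (not x ∧ y) ≡ x ∨ not y
  not-∧-not false y = refl
  not-∧-not true  y = refl
  size-∷ : ∀ {n} b (A : Subset n) → (if b then 1 else 0) ℕ.+ ∣ A ∣ ≡ ∣ b ∷ A ∣
  size-∷ true  A = refl
  size-∷ false A = refl

module _ where
  open ≡.≡-Reasoning

  -- Coefficient sequences and their Cauchy product
  -- (f ⊛ g) k = Σ_{i+j=k} f i · g j, computed by peeling off the constant term of f.
  Seq : Set
  Seq = ℕ → ℤ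

  infixl 7 _⊛_
  _⊛_ : Seq → Seq → Seq
  (f ⊛ g) zero    = f 0 * g 0
  (f ⊛ g) (suc k) = f 0 * g (suc k) + (f ∘ suc ⊛ g) k

  ⊛-cong : ∀ {f f′ g g′} → (∀ i → f i ≡ f′ i) → (∀ i → g i ≡ g′ i) → ∀ k → (f ⊛ g) k ≡ (f′ ⊛ g′) k
  ⊛-cong f≗f′ g≗g′ zero    = cong₂ _*_ (f≗f′ 0) (g≗g′ 0)
  ⊛-cong f≗f′ g≗g′ (suc k) = cong₂ _+_ (cong₂ _*_ (f≗f′ 0) (g≗g′ (suc k))) (⊛-cong (f≗f′ ∘ suc) g≗g′ k)

  ⊛-zeroˡ : ∀ {f} g → (∀ i → f i ≡ + 0) → ∀ k → (f ⊛ g) k ≡ + 0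
  ⊛-zeroˡ g f≗0 zero    rewrite f≗0 0 = refl
  ⊛-zeroˡ g f≗0 (suc k) rewrite f≗0 0 | ⊛-zeroˡ g (f≗0 ∘ suc) k = refl

  δ : Seq
  δ zero    = + 1
  δ (suc _) = + 0

  ⊛-identityˡ : ∀ g k → (δ ⊛ g) k ≡ g k
  ⊛-identityˡ g zero    = ℤP.*-identityˡ (g 0)
  ⊛-identityˡ g (suc k) rewrite ⊛-zeroˡ g (λ _ → refl) k =
    ≡.trans (ℤP.+-identityʳ _) (ℤP.*-identityˡ (g (suc k)))

  -- Peeling off the constant term of g instead of f; the key to commutativity.
  ⊛-peelʳ : ∀ f g k → (f ⊛ g) (suc k) ≡ (f ⊛ g ∘ suc) k + f (suc k) * g 0
  ⊛-peelʳ f g zero    = refl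
  ⊛-peelʳ f g (suc k) = begin
    f 0 * g (suc (suc k)) + (f ∘ suc ⊛ g) (suc k)
      ≡⟨ cong (λ z → f 0 * g (suc (suc k)) + z) (⊛-peelʳ (f ∘ suc) g k) ⟩
    f 0 * g (suc (suc k)) + ((f ∘ suc ⊛ g ∘ suc) k + f (suc (suc k)) * g 0)
      ≡⟨ ℤP.+-assoc (f 0 * g (suc (suc k))) ((f ∘ suc ⊛ g ∘ suc) k) (f (suc (suc k)) * g 0) ⟨
    (f ⊛ g ∘ suc) (suc k) + f (suc (suc k)) * g 0 ∎

  ⊛-comm : ∀ f g k → (f ⊛ g) k ≡ (g ⊛ f) k
  ⊛-comm f g zero    = ℤP.*-comm (f 0) (g 0)
  ⊛-comm f g (suc k) = begin
    f 0 * g (suc k) + (f ∘ suc ⊛ g) k ≡⟨ cong (λ z → f 0 * g (suc k) + z) (⊛-comm (f ∘ suc) g k) ⟩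
    f 0 * g (suc k) + (g ⊛ f ∘ suc) k ≡⟨ ℤP.+-comm (f 0 * g (suc k)) ((g ⊛ f ∘ suc) k) ⟩
    (g ⊛ f ∘ suc) k + f 0 * g (suc k) ≡⟨ cong (λ z → (g ⊛ f ∘ suc) k + z) (ℤP.*-comm (f 0) (g (suc k))) ⟩
    (g ⊛ f ∘ suc) k + g (suc k) * f 0 ≡⟨ ⊛-peelʳ g f k ⟨
    (g ⊛ f) (suc k) ∎

  ⊛-distribʳ : ∀ f g h k → ((λ i → f i + g i) ⊛ h) k ≡ (f ⊛ h) k + (g ⊛ h) k
  ⊛-distribʳ f g h zero    = ℤP.*-distribʳ-+ (h 0) (f 0) (g 0)
  ⊛-distribʳ f g h (suc k) rewrite ⊛-distribʳ (f ∘ suc) (g ∘ suc) h k =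
    shuffle (f 0) (g 0) (h (suc k)) ((f ∘ suc ⊛ h) k) ((g ∘ suc ⊛ h) k)
    where
    shuffle : ∀ a b c x y → (a + b) * c + (x + y) ≡ (a * c + x) + (b * c + y)
    shuffle = solve-∀

  ⊛-scaleˡ : ∀ c f h k → ((λ i → c * f i) ⊛ h) k ≡ c * (f ⊛ h) k
  ⊛-scaleˡ c f h zero    = ℤP.*-assoc c (f 0) (h 0)
  ⊛-scaleˡ c f h (suc k) rewrite ⊛-scaleˡ c (f ∘ suc) h k = factor c (f 0) (h (suc k)) ((f ∘ suc ⊛ h) k)
    where
    factor : ∀ c a b x → c * a * b + c * x ≡ c * (a * b + x)
    factor = solve-∀

  ⊛-assoc : ∀ f g h k → (f ⊛ g ⊛ h) k ≡ (f ⊛ (g ⊛ h)) k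
  ⊛-assoc f g h zero    = ℤP.*-assoc (f 0) (g 0) (h 0)
  ⊛-assoc f g h (suc k) = begin
    (f ⊛ g) 0 * h (suc k) + ((λ i → f 0 * g (suc i) + (f ∘ suc ⊛ g) i) ⊛ h) k
      ≡⟨ cong (λ z → (f ⊛ g) 0 * h (suc k) + z) (⊛-distribʳ _ _ h k) ⟩
    (f ⊛ g) 0 * h (suc k) + (((λ i → f 0 * g (suc i)) ⊛ h) k + (f ∘ suc ⊛ g ⊛ h) k)
      ≡⟨ cong₂ (λ u v → (f ⊛ g) 0 * h (suc k) + (u + v))
               (⊛-scaleˡ (f 0) (g ∘ suc) h k) (⊛-assoc (f ∘ suc) g h k) ⟩
    f 0 * g 0 * h (suc k) + (f 0 * (g ∘ suc ⊛ h) k + (f ∘ suc ⊛ (g ⊛ h)) k)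
      ≡⟨ regroup (f 0) (g 0) (h (suc k)) _ _ ⟩
    (f ⊛ (g ⊛ h)) (suc k) ∎
    where
    regroup : ∀ a b c x y → a * b * c + (a * x + y) ≡ a * (b * c + x) + y
    regroup = solve-∀

  coeff-+ₚ : ∀ p q k → coeff (p +ₚ q) k ≡ coeff p k + coeff q k
  coeff-+ₚ []      q       k       = ≡.sym (ℤP.+-identityˡ _)
  coeff-+ₚ (a ∷ p) []      k       = ≡.sym (ℤP.+-identityʳ _)
  coeff-+ₚ (a ∷ p) (b ∷ q) zero    = refl
  coeff-+ₚ (a ∷ p) (b ∷ q) (suc k) = coeff-+ₚ p q k

  coeff-scale : ∀ a q k → coeff (map (a *_) q) k ≡ a * coeff q k
  coeff-scale a []      k       = ≡.sym (ℤP.*-zeroʳ a)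
  coeff-scale a (b ∷ q) zero    = refl
  coeff-scale a (b ∷ q) (suc k) = coeff-scale a q k

  coeff-*ₚ : ∀ p q k → coeff (p *ₚ q) k ≡ (coeff p ⊛ coeff q) k
  coeff-*ₚ []      q k       = ≡.sym (⊛-zeroˡ (coeff q) (λ _ → refl) k)
  coeff-*ₚ (a ∷ p) q zero
    rewrite coeff-+ₚ (map (a *_) q) (+ 0 ∷ (p *ₚ q)) 0 | coeff-scale a q 0 = ℤP.+-identityʳ _
  coeff-*ₚ (a ∷ p) q (suc k)
    rewrite coeff-+ₚ (map (a *_) q) (+ 0 ∷ (p *ₚ q)) (suc k) | coeff-scale a q (suc k) | coeff-*ₚ p q k = refl

  -- Equality of polynomials: equality of all coefficients (trailing zeros are irrelevant).
  -- A record, so that both polynomials stay inferable from the type.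
  infix 4 _≐_
  record _≐_ (p q : Poly) : Set where
    constructor coeffwise
    field coeff-≡ : ∀ k → coeff p k ≡ coeff q k
  open _≐_ public

  ≐-refl : ∀ {p} → p ≐ p
  ≐-refl = coeffwise λ _ → refl

  ≐-trans : ∀ {p q r} → p ≐ q → q ≐ r → p ≐ r
  ≐-trans (coeffwise e) (coeffwise f) = coeffwise λ k → ≡.trans (e k) (f k)

  ≐-isEquivalence : IsEquivalence _≐_
  ≐-isEquivalence = record
    { refl = ≐-refl ; sym = λ (coeffwise e) → coeffwise λ k → ≡.sym (e k) ; trans = ≐-trans }

  1ₚ : Poly
  1ₚ = + 1 ∷ []

  +ₚ-cong : ∀ {p p′ q q′} → p ≐ p′ → q ≐ q′ → p +ₚ q ≐ p′ +ₚ q′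
  +ₚ-cong {p} {p′} {q} {q′} (coeffwise e) (coeffwise f) = coeffwise λ k → begin
    coeff (p +ₚ q) k        ≡⟨ coeff-+ₚ p q k ⟩
    coeff p k + coeff q k   ≡⟨ cong₂ _+_ (e k) (f k) ⟩
    coeff p′ k + coeff q′ k ≡⟨ coeff-+ₚ p′ q′ k ⟨
    coeff (p′ +ₚ q′) k      ∎

  +ₚ-assoc : ∀ p q r → (p +ₚ q) +ₚ r ≐ p +ₚ (q +ₚ r)
  +ₚ-assoc p q r = coeffwise λ k → begin
    coeff ((p +ₚ q) +ₚ r) k                ≡⟨ coeff-+ₚ (p +ₚ q) r k ⟩
    coeff (p +ₚ q) k + coeff r k           ≡⟨ cong (_+ coeff r k) (coeff-+ₚ p q k) ⟩
    coeff p k + coeff q k + coeff r k      ≡⟨ ℤP.+-assoc (coeff p k) (coeff q k) (coeff r k) ⟩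
    coeff p k + (coeff q k + coeff r k)    ≡⟨ cong (λ z → coeff p k + z) (coeff-+ₚ q r k) ⟨
    coeff p k + coeff (q +ₚ r) k           ≡⟨ coeff-+ₚ p (q +ₚ r) k ⟨
    coeff (p +ₚ (q +ₚ r)) k                ∎

  +ₚ-comm : ∀ p q → p +ₚ q ≐ q +ₚ p
  +ₚ-comm p q = coeffwise λ k → begin
    coeff (p +ₚ q) k      ≡⟨ coeff-+ₚ p q k ⟩
    coeff p k + coeff q k ≡⟨ ℤP.+-comm (coeff p k) (coeff q k) ⟩
    coeff q k + coeff p k ≡⟨ coeff-+ₚ q p k ⟨
    coeff (q +ₚ p) k      ∎

  +ₚ-identityʳ : ∀ p → p +ₚ [] ≐ p
  +ₚ-identityʳ p = coeffwise λ k → ≡.trans (coeff-+ₚ p [] k) (ℤP.+-identityʳ (coeff p k))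

  *ₚ-cong : ∀ {p p′ q q′} → p ≐ p′ → q ≐ q′ → p *ₚ q ≐ p′ *ₚ q′
  *ₚ-cong {p} {p′} {q} {q′} (coeffwise e) (coeffwise f) = coeffwise λ k → begin
    coeff (p *ₚ q) k          ≡⟨ coeff-*ₚ p q k ⟩
    (coeff p ⊛ coeff q) k     ≡⟨ ⊛-cong e f k ⟩
    (coeff p′ ⊛ coeff q′) k   ≡⟨ coeff-*ₚ p′ q′ k ⟨
    coeff (p′ *ₚ q′) k        ∎

  *ₚ-assoc : ∀ p q r → (p *ₚ q) *ₚ r ≐ p *ₚ (q *ₚ r)
  *ₚ-assoc p q r = coeffwise λ k → begin
    coeff ((p *ₚ q) *ₚ r) k                  ≡⟨ coeff-*ₚ (p *ₚ q) r k ⟩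
    (coeff (p *ₚ q) ⊛ coeff r) k             ≡⟨ ⊛-cong (coeff-*ₚ p q) (λ _ → refl) k ⟩
    (coeff p ⊛ coeff q ⊛ coeff r) k          ≡⟨ ⊛-assoc (coeff p) (coeff q) (coeff r) k ⟩
    (coeff p ⊛ (coeff q ⊛ coeff r)) k        ≡⟨ ⊛-cong (λ _ → refl) (coeff-*ₚ q r) k ⟨
    (coeff p ⊛ coeff (q *ₚ r)) k             ≡⟨ coeff-*ₚ p (q *ₚ r) k ⟨
    coeff (p *ₚ (q *ₚ r)) k                  ∎

  *ₚ-comm : ∀ p q → p *ₚ q ≐ q *ₚ p
  *ₚ-comm p q = coeffwise λ k → begin
    coeff (p *ₚ q) k      ≡⟨ coeff-*ₚ p q k ⟩
    (coeff p ⊛ coeff q) k ≡⟨ ⊛-comm (coeff p) (coeff q) k ⟩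
    (coeff q ⊛ coeff p) k ≡⟨ coeff-*ₚ q p k ⟨
    coeff (q *ₚ p) k      ∎

  *ₚ-identityˡ : ∀ p → 1ₚ *ₚ p ≐ p
  *ₚ-identityˡ p = coeffwise λ k → ≡.trans (coeff-*ₚ 1ₚ p k) (≡.trans (⊛-cong 1ₚ≗δ (λ _ → refl) k) (⊛-identityˡ (coeff p) k))
    where
    1ₚ≗δ : ∀ i → coeff 1ₚ i ≡ δ i
    1ₚ≗δ zero    = refl
    1ₚ≗δ (suc _) = refl

  *ₚ-distribʳ : ∀ r p q → (p +ₚ q) *ₚ r ≐ (p *ₚ r) +ₚ (q *ₚ r)
  *ₚ-distribʳ r p q = coeffwise λ k → begin
    coeff ((p +ₚ q) *ₚ r) k                                   ≡⟨ coeff-*ₚ (p +ₚ q) r k ⟩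
    (coeff (p +ₚ q) ⊛ coeff r) k                              ≡⟨ ⊛-cong (coeff-+ₚ p q) (λ _ → refl) k ⟩
    ((λ i → coeff p i + coeff q i) ⊛ coeff r) k               ≡⟨ ⊛-distribʳ (coeff p) (coeff q) (coeff r) k ⟩
    (coeff p ⊛ coeff r) k + (coeff q ⊛ coeff r) k             ≡⟨ cong₂ _+_ (coeff-*ₚ p r k) (coeff-*ₚ q r k) ⟨
    coeff (p *ₚ r) k + coeff (q *ₚ r) k                       ≡⟨ coeff-+ₚ (p *ₚ r) (q *ₚ r) k ⟨
    coeff ((p *ₚ r) +ₚ (q *ₚ r)) k                            ∎

-- ℤ[x] as a commutative semiring (it is a ring, but only the semiring laws are needed).
ℤ[x] : CommutativeSemiring 0ℓ 0ℓ
ℤ[x] = record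
  { Carrier = Poly ; _≈_ = _≐_ ; _+_ = _+ₚ_ ; _*_ = _*ₚ_ ; 0# = [] ; 1# = 1ₚ
  ; isCommutativeSemiring = isCommutativeSemiringˡ record
    { +-isCommutativeMonoid = commutativeMonoid +ₚ-cong +ₚ-assoc (λ _ → ≐-refl) +ₚ-identityʳ +ₚ-comm
    ; *-isCommutativeMonoid = commutativeMonoid *ₚ-cong *ₚ-assoc *ₚ-identityˡ
                                (λ p → ≐-trans (*ₚ-comm p 1ₚ) (*ₚ-identityˡ p)) *ₚ-comm
    ; distribʳ = *ₚ-distribʳ
    ; zeroˡ    = λ _ → ≐-refl
    }
  }
  where
  commutativeMonoid : ∀ {_∙_ : Poly → Poly → Poly} {ε} →
    (∀ {p p′ q q′} → p ≐ p′ → q ≐ q′ → (p ∙ q) ≐ (p′ ∙ q′)) →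
    (∀ p q r → ((p ∙ q) ∙ r) ≐ (p ∙ (q ∙ r))) →
    (∀ p → (ε ∙ p) ≐ p) → (∀ p → (p ∙ ε) ≐ p) → (∀ p q → (p ∙ q) ≐ (q ∙ p)) →
    IsCommutativeMonoid _≐_ _∙_ ε
  commutativeMonoid ∙-cong assoc idˡ idʳ comm = record
    { isMonoid = record
      { isSemigroup = record { isMagma = record { isEquivalence = ≐-isEquivalence ; ∙-cong = ∙-cong } ; assoc = assoc }
      ; identity = idˡ , idʳ }
    ; comm = comm }

-- One-sided congruences fixing the other operand (which Agda cannot infer).
+ₚ-congˡ : ∀ p {q q′} → q ≐ q′ → (p +ₚ q) ≐ (p +ₚ q′)
+ₚ-congˡ p = +ₚ-cong (≐-refl {p})

*ₚ-congˡ : ∀ p {q q′} → q ≐ q′ → (p *ₚ q) ≐ (p *ₚ q′)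
*ₚ-congˡ p = *ₚ-cong (≐-refl {p})

*ₚ-congʳ : ∀ q {p p′} → p ≐ p′ → (p *ₚ q) ≐ (p′ *ₚ q)
*ₚ-congʳ q e = *ₚ-cong e (≐-refl {q})

open CommutativeSemiring ℤ[x] using
  (setoid; sym; reflexive; zeroʳ; distribˡ; *-comm; *-assoc; *-identityˡ; *-monoid; *-commutativeSemigroup)
open SetoidReasoning setoid
open CommutativeSemigroupProperties *-commutativeSemigroup using (x∙yz≈y∙xz)

sumOver : {X : Set} → List X → (X → Poly) → Poly
sumOver []       f = []
sumOver (x ∷ xs) f = f x +ₚ sumOver xs f

module _ {X : Set} where

  sumOver-cong : ∀ (xs : List X) {f g} → (∀ x → f x ≐ g x) → sumOver xs f ≐ sumOver xs g
  sumOver-cong []       f≐g = ≐-refl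
  sumOver-cong (x ∷ xs) f≐g = +ₚ-cong (f≐g x) (sumOver-cong xs f≐g)

  sumOver-++ : ∀ (xs ys : List X) f → sumOver (xs List.++ ys) f ≐ (sumOver xs f +ₚ sumOver ys f)
  sumOver-++ []       ys f = ≐-refl
  sumOver-++ (x ∷ xs) ys f = begin
    f x +ₚ sumOver (xs List.++ ys) f       ≈⟨ +ₚ-congˡ (f x) (sumOver-++ xs ys f) ⟩
    f x +ₚ (sumOver xs f +ₚ sumOver ys f)  ≈⟨ +ₚ-assoc (f x) _ _ ⟨
    (f x +ₚ sumOver xs f) +ₚ sumOver ys f  ∎

  sumOver-map : ∀ {Y : Set} (h : Y → X) (ys : List Y) f → sumOver (map h ys) f ≡ sumOver ys (f ∘ h)
  sumOver-map h []       f = refl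
  sumOver-map h (y ∷ ys) f = cong (f (h y) +ₚ_) (sumOver-map h ys f)

  *-distribˡ-sumOver : ∀ (xs : List X) c f → sumOver xs (λ x → c *ₚ f x) ≐ (c *ₚ sumOver xs f)
  *-distribˡ-sumOver []       c f = sym (zeroʳ c)
  *-distribˡ-sumOver (x ∷ xs) c f = begin
    (c *ₚ f x) +ₚ (sumOver xs (λ x → c *ₚ f x)) ≈⟨ +ₚ-congˡ (c *ₚ f x) (*-distribˡ-sumOver xs c f) ⟩
    (c *ₚ f x) +ₚ (c *ₚ sumOver xs f)      ≈⟨ distribˡ c (f x) (sumOver xs f) ⟨
    c *ₚ (f x +ₚ sumOver xs f)         ∎

  *-distribʳ-sumOver : ∀ (xs : List X) c f → sumOver xs (λ x → f x *ₚ c) ≐ (sumOver xs f *ₚ c)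
  *-distribʳ-sumOver xs c f = begin
    sumOver xs (λ x → f x *ₚ c)  ≈⟨ sumOver-cong xs (λ x → *-comm (f x) c) ⟩
    sumOver xs (λ x → c *ₚ f x)  ≈⟨ *-distribˡ-sumOver xs c f ⟩
    c *ₚ sumOver xs f       ≈⟨ *-comm c _ ⟩
    sumOver xs f *ₚ c       ∎

∏ : ∀ q → (Fin q → Poly) → Poly
∏ q = MonoidSum.sum *-monoid {q}

∏-cong : ∀ q {f g} → (∀ i → f i ≐ g i) → ∏ q f ≐ ∏ q g
∏-cong q = MonoidSum.sum-cong-≋ *-monoid {q}

Σ⊆ : ∀ n → (Subset n → Poly) → Poly
Σ⊆ n = sumOver (allSubsets n)

Σ⊆-cong : ∀ n {f g} → (∀ S → f S ≐ g S) → Σ⊆ n f ≐ Σ⊆ n g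
Σ⊆-cong n = sumOver-cong (allSubsets n)

Σ⊆-suc : ∀ n f → Σ⊆ (suc n) f ≐ (Σ⊆ n (f ∘ (true ∷_)) +ₚ Σ⊆ n (f ∘ (false ∷_)))
Σ⊆-suc n f = begin
  sumOver (map (true ∷_) (allSubsets n) List.++ map (false ∷_) (allSubsets n)) f
    ≈⟨ sumOver-++ (map (true ∷_) (allSubsets n)) _ f ⟩
  sumOver (map (true ∷_) (allSubsets n)) f +ₚ sumOver (map (false ∷_) (allSubsets n)) f
    ≡⟨ cong₂ _+ₚ_ (sumOver-map (true ∷_) (allSubsets n) f) (sumOver-map (false ∷_) (allSubsets n) f) ⟩
  Σ⊆ n (f ∘ (true ∷_)) +ₚ Σ⊆ n (f ∘ (false ∷_)) ∎

Σ⊆-++ : ∀ a b f → Σ⊆ (a ℕ.+ b) f ≐ Σ⊆ a (λ A → Σ⊆ b (λ B → f (A ++ B)))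
Σ⊆-++ zero    b f = sym (+ₚ-identityʳ (Σ⊆ b f))
Σ⊆-++ (suc a) b f = begin
  Σ⊆ (suc (a ℕ.+ b)) f
    ≈⟨ Σ⊆-suc (a ℕ.+ b) f ⟩
  Σ⊆ (a ℕ.+ b) (f ∘ (true ∷_)) +ₚ Σ⊆ (a ℕ.+ b) (f ∘ (false ∷_))
    ≈⟨ +ₚ-cong (Σ⊆-++ a b (f ∘ (true ∷_))) (Σ⊆-++ a b (f ∘ (false ∷_))) ⟩
  Σ⊆ a (λ A → Σ⊆ b (λ B → f (true ∷ A ++ B))) +ₚ Σ⊆ a (λ A → Σ⊆ b (λ B → f (false ∷ A ++ B)))
    ≈⟨ Σ⊆-suc a (λ A → Σ⊆ b (λ B → f (A ++ B))) ⟨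
  Σ⊆ (suc a) (λ A → Σ⊆ b (λ B → f (A ++ B))) ∎

*-distribˡ-Σ⊆ : ∀ n c f → Σ⊆ n (λ S → c *ₚ f S) ≐ (c *ₚ Σ⊆ n f)
*-distribˡ-Σ⊆ n = *-distribˡ-sumOver (allSubsets n)

*-distribʳ-Σ⊆ : ∀ n c f → Σ⊆ n (λ S → f S *ₚ c) ≐ (Σ⊆ n f *ₚ c)
*-distribʳ-Σ⊆ n = *-distribʳ-sumOver (allSubsets n)

take-++ : ∀ {A : Set} {m k} (xs : Vec A m) (ys : Vec A k) → take m (xs ++ ys) ≡ xs
take-++ []       ys = refl
take-++ (x ∷ xs) ys = cong (x ∷_) (take-++ xs ys)

drop-++ : ∀ {A : Set} {m k} (xs : Vec A m) (ys : Vec A k) → drop m (xs ++ ys) ≡ ys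
drop-++ []       ys = refl
drop-++ (x ∷ xs) ys = drop-++ xs ys

block : ∀ q m → Subset (q ℕ.* m) → Fin q → Subset m
block (suc q) m B zero    = take m B
block (suc q) m B (suc i) = block q m (drop m B) i

lookup-block : ∀ q m (B : Subset (q ℕ.* m)) y →
  lookup B y ≡ lookup (block q m B (proj₁ (remQuot m y))) (proj₂ (remQuot {q} m y))
lookup-block (suc q) m B y =
  ≡.trans (cong (λ B′ → lookup B′ y) (≡.sym (take++drop≡id m B)))
          (≡.trans (lookup-splitAt m (take m B) (drop m B) y) byHalf)
  where
  byHalf : [ lookup (take m B) , lookup (drop m B) ]′ (splitAt m y)
         ≡ lookup (block (suc q) m B (proj₁ (remQuot m y))) (proj₂ (remQuot {suc q} m y))
  byHalf with splitAt m y
  ... | inj₁ a  = refl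
  ... | inj₂ y′ = lookup-block q m (drop m B) y′

Σ⊆-∏ : ∀ q m g → Σ⊆ (q ℕ.* m) (λ B → ∏ q (λ i → g i (block q m B i))) ≐ ∏ q (λ i → Σ⊆ m (g i))
Σ⊆-∏ zero    m g = +ₚ-identityʳ 1ₚ
Σ⊆-∏ (suc q) m g = begin
  Σ⊆ (m ℕ.+ q ℕ.* m) (λ B → g zero (take m B) *ₚ rest (drop m B))
    ≈⟨ Σ⊆-++ m (q ℕ.* m) (λ B → g zero (take m B) *ₚ rest (drop m B)) ⟩
  Σ⊆ m (λ A → Σ⊆ (q ℕ.* m) (λ B → g zero (take m (A ++ B)) *ₚ rest (drop m (A ++ B))))
    ≈⟨ Σ⊆-cong m (λ A → Σ⊆-cong (q ℕ.* m) (λ B →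
         reflexive (cong₂ (λ A′ B′ → g zero A′ *ₚ rest B′) (take-++ A B) (drop-++ A B)))) ⟩
  Σ⊆ m (λ A → Σ⊆ (q ℕ.* m) (λ B → g zero A *ₚ rest B))
    ≈⟨ Σ⊆-cong m (λ A → *-distribˡ-Σ⊆ (q ℕ.* m) (g zero A) rest) ⟩
  Σ⊆ m (λ A → g zero A *ₚ Σ⊆ (q ℕ.* m) rest)
    ≈⟨ *-distribʳ-Σ⊆ m (Σ⊆ (q ℕ.* m) rest) (g zero) ⟩
  Σ⊆ m (g zero) *ₚ Σ⊆ (q ℕ.* m) rest
    ≈⟨ *ₚ-congˡ (Σ⊆ m (g zero)) (Σ⊆-∏ q m (λ i → g (suc i))) ⟩
  Σ⊆ m (g zero) *ₚ ∏ q (λ i → Σ⊆ m (g (suc i))) ∎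
  where
  rest : Subset (q ℕ.* m) → Poly
  rest B = ∏ q (λ i → g (suc i) (block q m B i))

^ₚ-+ : ∀ p a b → (p ^ₚ (a ℕ.+ b)) ≐ ((p ^ₚ a) *ₚ (p ^ₚ b))
^ₚ-+ p zero    b = sym (*-identityˡ (p ^ₚ b))
^ₚ-+ p (suc a) b = begin
  p *ₚ (p ^ₚ (a ℕ.+ b))        ≈⟨ *ₚ-congˡ p (^ₚ-+ p a b) ⟩
  p *ₚ ((p ^ₚ a) *ₚ (p ^ₚ b))  ≈⟨ *-assoc p (p ^ₚ a) (p ^ₚ b) ⟨
  (p *ₚ (p ^ₚ a)) *ₚ (p ^ₚ b)  ∎

extract-power : ∀ {e c} → e ≤ c → ∀ w X Y →
  (w *ₚ ((X ^ₚ c) *ₚ Y)) ≐ ((X ^ₚ e) *ₚ (w *ₚ ((X ^ₚ (c ∸ e)) *ₚ Y)))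
extract-power {e} {c} e≤c w X Y = begin
  w *ₚ ((X ^ₚ c) *ₚ Y)                          ≡⟨ cong (λ k → w *ₚ ((X ^ₚ k) *ₚ Y)) (ℕP.m+[n∸m]≡n e≤c) ⟨
  w *ₚ ((X ^ₚ (e ℕ.+ (c ∸ e))) *ₚ Y)            ≈⟨ *ₚ-congˡ w (*ₚ-congʳ Y (^ₚ-+ X e (c ∸ e))) ⟩
  w *ₚ (((X ^ₚ e) *ₚ (X ^ₚ (c ∸ e))) *ₚ Y)      ≈⟨ *ₚ-congˡ w (*-assoc (X ^ₚ e) (X ^ₚ (c ∸ e)) Y) ⟩
  w *ₚ ((X ^ₚ e) *ₚ ((X ^ₚ (c ∸ e)) *ₚ Y))      ≈⟨ x∙yz≈y∙xz w (X ^ₚ e) ((X ^ₚ (c ∸ e)) *ₚ Y) ⟩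
  (X ^ₚ e) *ₚ (w *ₚ ((X ^ₚ (c ∸ e)) *ₚ Y))      ∎

∏-select : ∀ q (f : Fin q → Bool) X Y →
  ∏ q (λ i → if f i then X else Y) ≐ ((X ^ₚ trues q f) *ₚ (Y ^ₚ trues q (not ∘ f)))
∏-select zero    f X Y = sym (*-identityˡ 1ₚ)
∏-select (suc q) f X Y with f zero
... | true  = begin
  X *ₚ ∏ q (λ i → if f (suc i) then X else Y)  ≈⟨ *ₚ-congˡ X (∏-select q (f ∘ suc) X Y) ⟩
  X *ₚ ((X ^ₚ a) *ₚ (Y ^ₚ b))                  ≈⟨ *-assoc X (X ^ₚ a) (Y ^ₚ b) ⟨
  (X *ₚ (X ^ₚ a)) *ₚ (Y ^ₚ b)                  ∎
  where
  a b : ℕ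
  a = trues q (f ∘ suc)
  b = trues q (not ∘ f ∘ suc)
... | false = begin
  Y *ₚ ∏ q (λ i → if f (suc i) then X else Y)  ≈⟨ *ₚ-congˡ Y (∏-select q (f ∘ suc) X Y) ⟩
  Y *ₚ ((X ^ₚ a) *ₚ (Y ^ₚ b))                  ≈⟨ x∙yz≈y∙xz Y (X ^ₚ a) (Y ^ₚ b) ⟩
  (X ^ₚ a) *ₚ (Y *ₚ (Y ^ₚ b))                  ∎
  where
  a b : ℕ
  a = trues q (f ∘ suc)
  b = trues q (not ∘ f ∘ suc)

xPow : ℕ → Poly
xPow zero    = 1ₚ
xPow (suc s) = + 0 ∷ xPow s

coeff-xPow : ∀ s k → coeff (xPow s) k ≡ (if s ≡ᵇ k then + 1 else + 0)
coeff-xPow zero    zero    = refl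
coeff-xPow zero    (suc k) = refl
coeff-xPow (suc s) zero    = refl
coeff-xPow (suc s) (suc k) = coeff-xPow s k

x*ₚ : ∀ p q → ((+ 0 ∷ p) *ₚ q) ≐ (+ 0 ∷ (p *ₚ q))
x*ₚ p q = coeffwise λ
  { zero    → coeff-*ₚ (+ 0 ∷ p) q zero
  ; (suc k) → ≡.trans (coeff-*ₚ (+ 0 ∷ p) q (suc k))
                (≡.trans (ℤP.+-identityˡ _) (≡.sym (coeff-*ₚ p q k))) }

xPow-+ : ∀ s t → xPow (s ℕ.+ t) ≐ (xPow s *ₚ xPow t)
xPow-+ zero    t = sym (*-identityˡ (xPow t))
xPow-+ (suc s) t = begin
  + 0 ∷ xPow (s ℕ.+ t)         ≈⟨ coeffwise (λ { zero → refl ; (suc k) → coeff-≡ (xPow-+ s t) k }) ⟩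
  + 0 ∷ (xPow s *ₚ xPow t)     ≈⟨ x*ₚ (xPow s) (xPow t) ⟨
  (+ 0 ∷ xPow s) *ₚ xPow t     ∎

-- weight b s = xˢ if b holds and 0 otherwise: the contribution of a set of size s.
weight : Bool → ℕ → Poly
weight true  s = xPow s
weight false s = []

weight-∧ : ∀ a b s t → weight (a ∧ b) (s ℕ.+ t) ≐ (weight a s *ₚ weight b t)
weight-∧ false b    s t = ≐-refl
weight-∧ true false s t = sym (zeroʳ (xPow s))
weight-∧ true true  s t = xPow-+ s t

coeff-weight : ∀ b s k → coeff (weight b s) k ≡ (if b ∧ (s ≡ᵇ k) then + 1 else + 0)
coeff-weight false s k = refl
coeff-weight true  s k = coeff-xPow s k

coeff-Σweight : ∀ {n} (P : Subset n → Bool) (Ls : List (Subset n)) k →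
  coeff (sumOver Ls (λ S → weight (P S) ∣ S ∣)) k
    ≡ + length (filter (λ S → (P S ∧ (∣ S ∣ ≡ᵇ k)) Bool.≟ true) Ls)
coeff-Σweight P []       k = refl
coeff-Σweight P (S ∷ Ls) k
  rewrite coeff-+ₚ (weight (P S) ∣ S ∣) (sumOver Ls (λ S → weight (P S) ∣ S ∣)) k
        | coeff-weight (P S) ∣ S ∣ k | coeff-Σweight P Ls k
  with P S ∧ (∣ S ∣ ≡ᵇ k)
... | true  = refl
... | false = ℤP.+-identityˡ _

coeff-tabulate : ∀ (g : ℕ → ℤ) h N k → (N ≤ k → g (h k) ≡ + 0) → coeff (map g (applyUpTo h N)) k ≡ g (h k)
coeff-tabulate g h zero    k       vanish = ≡.sym (vanish z≤n)
coeff-tabulate g h (suc N) zero    vanish = refl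
coeff-tabulate g h (suc N) (suc k) vanish = coeff-tabulate g (h ∘ suc) N k (vanish ∘ s≤s)

indepCount-vanishes : ∀ G k → suc (order G) ≤ k → indepCount G k ≡ 0
indepCount-vanishes G k n<k = cong length (filter-none _ (universal tooLarge (allSubsets (order G))))
  where
  tooLarge : ∀ S → (isIndependent G S ∧ (∣ S ∣ ≡ᵇ k)) ≢ true
  tooLarge S indepOfSizeK = ℕP.<-irrefl (ℕP.≡ᵇ⇒≡ ∣ S ∣ k sizeIsK) (ℕP.<-≤-trans (s≤s (∣p∣≤n S)) n<k)
    where
    sizeIsK : T (∣ S ∣ ≡ᵇ k)
    sizeIsK = ≡.subst T (≡.sym (∧-conicalʳ (isIndependent G S) _ indepOfSizeK)) _

indepPoly-as-sum : ∀ G → indepPoly G ≐ Σ⊆ (order G) (λ S → weight (isIndependent G S) ∣ S ∣)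
indepPoly-as-sum G = coeffwise λ k →
  ≡.trans (coeff-tabulate (λ k → + indepCount G k) (λ i → i) (suc (order G)) k
             (cong +_ ∘ indepCount-vanishes G k))
          (≡.sym (coeff-Σweight (isIndependent G) (allSubsets (order G)) k))

size-++ : ∀ {a b} (A : Subset a) (B : Subset b) → ∣ A ++ B ∣ ≡ ∣ A ∣ ℕ.+ ∣ B ∣
size-++ []          B = refl
size-++ (true ∷ A)  B = cong suc (size-++ A B)
size-++ (false ∷ A) B = size-++ A B

∏-weight : ∀ q m (c : Fin q → Subset m → Bool) B →
  ∏ q (λ i → weight (c i (block q m B i)) ∣ block q m B i ∣) ≐ weight (∀ᵇ q (λ i → c i (block q m B i))) ∣ B ∣
∏-weight zero    m c [] = ≐-refl
∏-weight (suc q) m c B = begin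
  weight (c zero (take m B)) ∣ take m B ∣ *ₚ ∏ q (λ i → weight (c (suc i) (block q m (drop m B) i)) ∣ block q m (drop m B) i ∣)
    ≈⟨ *ₚ-congˡ (weight (c zero (take m B)) ∣ take m B ∣) (∏-weight q m (c ∘ suc) (drop m B)) ⟩
  weight (c zero (take m B)) ∣ take m B ∣ *ₚ weight (∀ᵇ q (λ i → c (suc i) (block q m (drop m B) i))) ∣ drop m B ∣
    ≈⟨ weight-∧ (c zero (take m B)) (∀ᵇ q (λ i → c (suc i) (block q m (drop m B) i))) ∣ take m B ∣ ∣ drop m B ∣ ⟨
  weight (∀ᵇ (suc q) (λ i → c i (block (suc q) m B i))) (∣ take m B ∣ ℕ.+ ∣ drop m B ∣)
    ≡⟨ cong (weight (∀ᵇ (suc q) (λ i → c i (block (suc q) m B i))))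
            (≡.trans (≡.sym (size-++ (take m B) (drop m B))) (cong ∣_∣ (take++drop≡id m B))) ⟩
  weight (∀ᵇ (suc q) (λ i → c i (block (suc q) m B i))) ∣ B ∣ ∎

module CliqueCoverProduct (G : Graph) {q : ℕ} (C : CliqueCover G q) (H : Graph) (U : Subset (order H)) where

  open CommutativeMonoid ∧-commutativeMonoid using () renaming (commutativeSemigroup to ∧-commutativeSemigroup)
  open CommutativeSemigroupProperties ∧-commutativeSemigroup using ()
    renaming (x∙yz≈y∙xz to ∧-swapˡ; interchange to ∧-interchange)

  n m : ℕ
  n = order G
  m = order H

  P : Graph
  P = cliqueCoverProduct G C H U

  Vertex : Set
  Vertex = Fin n ⊎ (Fin q × Fin m)

  -- A subset of V(P) is A ++ B with A ⊆ V(G) and B the concatenation of q subsets of V(H).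
  member : Subset n → Subset (q ℕ.* m) → Vertex → Bool
  member A B (inj₁ u)       = lookup A u
  member A B (inj₂ (i , a)) = lookup (block q m B i) a

  decode-splitAt : ∀ x → decode n q m x ≡ [ inj₁ , inj₂ ∘ remQuot m ]′ (splitAt n x)
  decode-splitAt x with splitAt n x
  ... | inj₁ _ = refl
  ... | inj₂ _ = refl

  lookup-decode : ∀ (A : Subset n) (B : Subset (q ℕ.* m)) x → lookup (A ++ B) x ≡ member A B (decode n q m x)
  lookup-decode A B x rewrite lookup-splitAt n A B x | decode-splitAt x with splitAt n x
  ... | inj₁ u = refl
  ... | inj₂ y = lookup-block q m B y

  encode : Vertex → Fin (n ℕ.+ q ℕ.* m)
  encode (inj₁ u)       = u ↑ˡ (q ℕ.* m)
  encode (inj₂ (i , a)) = n ↑ʳ combine i a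

  decode-encode : ∀ d → decode n q m (encode d) ≡ d
  decode-encode (inj₁ u)
    rewrite decode-splitAt (u ↑ˡ (q ℕ.* m)) | splitAt-↑ˡ n u (q ℕ.* m) = refl
  decode-encode (inj₂ (i , a))
    rewrite decode-splitAt (n ↑ʳ combine i a) | splitAt-↑ʳ n (q ℕ.* m) (combine {q} {m} i a)
          | remQuot-combine {q} {m} i a = refl

  NoEdge : Subset n → Subset (q ℕ.* m) → Vertex → Vertex → Set
  NoEdge A B d e = not (member A B d ∧ member A B e ∧ starAdj G C H U d e) ≡ true

  noEdge-decode : ∀ A B x y →
    not (lookup (A ++ B) x ∧ lookup (A ++ B) y ∧ adj P x y)
      ≡ not (member A B (decode n q m x) ∧ member A B (decode n q m y) ∧ starAdj G C H U (decode n q m x) (decode n q m y))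
  noEdge-decode A B x y =
    cong₂ (λ s t → not (s ∧ t ∧ adj P x y)) (lookup-decode A B x) (lookup-decode A B y)

  independent⇒noEdge : ∀ A B → isIndependent P (A ++ B) ≡ true → ∀ d e → NoEdge A B d e
  independent⇒noEdge A B indep d e =
    ≡.subst₂ (NoEdge A B) (decode-encode d) (decode-encode e)
      (≡.trans (≡.sym (noEdge-decode A B (encode d) (encode e)))
               (isIndependent-sound P (A ++ B) indep (encode d) (encode e)))

  noEdge⇒independent : ∀ A B → (∀ d e → NoEdge A B d e) → isIndependent P (A ++ B) ≡ true
  noEdge⇒independent A B noEdge = isIndependent-complete P (A ++ B) λ x y →
    ≡.trans (noEdge-decode A B x y) (noEdge (decode n q m x) (decode n q m y))

  avoidsU : Subset m → Bool
  avoidsU Bᵢ = ∀ᵇ m (λ a → not (lookup Bᵢ a ∧ lookup U a))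

  -- Block i is admissible for A: independent in H, and not joined to A,
  -- which means A avoids clique i or Bᵢ avoids U.
  admissible : Subset n → Fin q → Subset m → Bool
  admissible A i Bᵢ = isIndependent H Bᵢ ∧ (avoids (cls C) i A ∨ avoidsU Bᵢ)

  crossFree : Fin q → Subset n → Subset m → Bool
  crossFree i A Bᵢ = ∀ᵇ n (λ u → ∀ᵇ m (λ a → not (lookup A u ∧ lookup Bᵢ a ∧ (⌊ cls C u ≟ i ⌋ ∧ lookup U a))))

  crossFree-split : ∀ i A Bᵢ → crossFree i A Bᵢ ≡ (avoids (cls C) i A ∨ avoidsU Bᵢ)
  crossFree-split i A Bᵢ =
    ≡.trans (∀ᵇ-cong n λ u → ∀ᵇ-cong m λ a → cong not (regroup (lookup A u) (lookup Bᵢ a) _ _))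
            (∀ᵇ-split n m (λ u → lookup A u ∧ ⌊ cls C u ≟ i ⌋) (λ a → lookup Bᵢ a ∧ lookup U a))
    where
    regroup : ∀ x y z w → x ∧ y ∧ (z ∧ w) ≡ (x ∧ z) ∧ (y ∧ w)
    regroup x y z w = ≡.trans (≡.sym (∧-assoc x y (z ∧ w))) (∧-interchange x y z w)

  admissiblePair : Subset n → Subset (q ℕ.* m) → Bool
  admissiblePair A B = isIndependent G A ∧ ∀ᵇ q (λ i → admissible A i (block q m B i))

  independent⇒admissible : ∀ A B → isIndependent P (A ++ B) ≡ true → admissiblePair A B ≡ true
  independent⇒admissible A B indep =
    cong₂ _∧_ (isIndependent-complete G A (λ u v → noEdge (inj₁ u) (inj₁ v)))
              (∀ᵇ-complete q λ i → cong₂ _∧_ (indepBlock i) (crossFreeBlock i))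
    where
    noEdge : ∀ d e → NoEdge A B d e
    noEdge = independent⇒noEdge A B indep
    -- Inside the i-th copy, P-adjacency is H-adjacency, since ⌊ i ≟ i ⌋ holds.
    indepBlock : ∀ i → isIndependent H (block q m B i) ≡ true
    indepBlock i = isIndependent-complete H (block q m B i) λ a b →
      ≡.subst (λ t → not (lookup (block q m B i) a ∧ lookup (block q m B i) b ∧ (t ∧ adj H a b)) ≡ true)
              (≡.trans (isYes≗does (i ≟ i)) (dec-true (i ≟ i) refl))
              (noEdge (inj₂ (i , a)) (inj₂ (i , b)))
    crossFreeBlock : ∀ i → (avoids (cls C) i A ∨ avoidsU (block q m B i)) ≡ true
    crossFreeBlock i = ≡.trans (≡.sym (crossFree-split i A (block q m B i)))
      (∀ᵇ-complete n λ u → ∀ᵇ-complete m λ a → noEdge (inj₁ u) (inj₂ (i , a)))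

  admissible⇒independent : ∀ A B → admissiblePair A B ≡ true → isIndependent P (A ++ B) ≡ true
  admissible⇒independent A B ok = noEdge⇒independent A B noEdge
    where
    admissibleBlock : ∀ i → admissible A i (block q m B i) ≡ true
    admissibleBlock = ∀ᵇ-sound q (∧-conicalʳ (isIndependent G A) _ ok)
    cross : ∀ i → crossFree i A (block q m B i) ≡ true
    cross i = ≡.trans (crossFree-split i A (block q m B i))
                      (∧-conicalʳ (isIndependent H (block q m B i)) _ (admissibleBlock i))
    noEdge : ∀ d e → NoEdge A B d e
    noEdge (inj₁ u)       (inj₁ v)       = isIndependent-sound G A (∧-conicalˡ _ _ ok) u v
    noEdge (inj₁ u)       (inj₂ (i , a)) = ∀ᵇ-sound m (∀ᵇ-sound n (cross i) u) a
    noEdge (inj₂ (i , a)) (inj₁ u)       =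
      ≡.trans (cong not (∧-swapˡ (lookup (block q m B i) a) (lookup A u) _)) (noEdge (inj₁ u) (inj₂ (i , a)))
    -- Two copies of H are never joined; within one copy, Bᵢ is independent in H.
    noEdge (inj₂ (i , a)) (inj₂ (j , b)) with i ≟ j
    ... | yes refl = isIndependent-sound H (block q m B i) (∧-conicalˡ _ _ (admissibleBlock i)) a b
    ... | no  _    rewrite ∧-zeroʳ (lookup (block q m B j) b) = cong not (∧-zeroʳ (lookup (block q m B i) a))

  isIndependent-product : ∀ A B → isIndependent P (A ++ B) ≡ admissiblePair A B
  isIndependent-product A B = ⇔→≡ {z = true} (mk⇔ (independent⇒admissible A B) (admissible⇒independent A B))

  -- I(H − U; x), written as a sum over the subsets of V(H) avoiding U.
  I[H-U] : Poly
  I[H-U] = Σ⊆ m (λ Bᵢ → weight (isIndependent H Bᵢ ∧ avoidsU Bᵢ) ∣ Bᵢ ∣)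

  Σ-admissible : ∀ A i →
    Σ⊆ m (λ Bᵢ → weight (admissible A i Bᵢ) ∣ Bᵢ ∣) ≐ (if avoids (cls C) i A then indepPoly H else I[H-U])
  Σ-admissible A i with avoids (cls C) i A
  ... | true  = begin
    Σ⊆ m (λ Bᵢ → weight (isIndependent H Bᵢ ∧ true) ∣ Bᵢ ∣)
      ≈⟨ Σ⊆-cong m (λ Bᵢ → reflexive (cong (λ t → weight t ∣ Bᵢ ∣) (∧-identityʳ (isIndependent H Bᵢ)))) ⟩
    Σ⊆ m (λ Bᵢ → weight (isIndependent H Bᵢ) ∣ Bᵢ ∣)
      ≈⟨ indepPoly-as-sum H ⟨
    indepPoly H ∎
  ... | false = ≐-refl

  avoided : Subset n → ℕ
  avoided A = trues q (λ i → avoids (cls C) i A)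

  met : Subset n → ℕ
  met A = trues q (not ∘ λ i → avoids (cls C) i A)

  indepPoly-expansion : indepPoly P ≐ Σ⊆ n (λ A →
    weight (isIndependent G A) ∣ A ∣ *ₚ ((indepPoly H ^ₚ avoided A) *ₚ (I[H-U] ^ₚ met A)))
  indepPoly-expansion = begin
    indepPoly P
      ≈⟨ indepPoly-as-sum P ⟩
    Σ⊆ (n ℕ.+ q ℕ.* m) (λ S → weight (isIndependent P S) ∣ S ∣)
      ≈⟨ Σ⊆-++ n (q ℕ.* m) (λ S → weight (isIndependent P S) ∣ S ∣) ⟩
    Σ⊆ n (λ A → Σ⊆ (q ℕ.* m) (λ B → weight (isIndependent P (A ++ B)) ∣ A ++ B ∣))
      ≈⟨ Σ⊆-cong n (λ A → Σ⊆-cong (q ℕ.* m) (λ B → term A B)) ⟩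
    Σ⊆ n (λ A → Σ⊆ (q ℕ.* m) (λ B → wA A *ₚ ∏ q (λ i → blockWeight A i (block q m B i))))
      ≈⟨ Σ⊆-cong n (λ A → *-distribˡ-Σ⊆ (q ℕ.* m) (wA A) (λ B → ∏ q (λ i → blockWeight A i (block q m B i)))) ⟩
    Σ⊆ n (λ A → wA A *ₚ Σ⊆ (q ℕ.* m) (λ B → ∏ q (λ i → blockWeight A i (block q m B i))))
      ≈⟨ Σ⊆-cong n (λ A → *ₚ-congˡ (wA A) (Σ⊆-∏ q m (blockWeight A))) ⟩
    Σ⊆ n (λ A → wA A *ₚ ∏ q (λ i → Σ⊆ m (blockWeight A i)))
      ≈⟨ Σ⊆-cong n (λ A → *ₚ-congˡ (wA A) (∏-cong q (Σ-admissible A))) ⟩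
    Σ⊆ n (λ A → wA A *ₚ ∏ q (λ i → if avoids (cls C) i A then indepPoly H else I[H-U]))
      ≈⟨ Σ⊆-cong n (λ A → *ₚ-congˡ (wA A) (∏-select q (λ i → avoids (cls C) i A) (indepPoly H) I[H-U])) ⟩
    Σ⊆ n (λ A → wA A *ₚ ((indepPoly H ^ₚ avoided A) *ₚ (I[H-U] ^ₚ met A))) ∎
    where
    wA : Subset n → Poly
    wA A = weight (isIndependent G A) ∣ A ∣
    blockWeight : Subset n → Fin q → Subset m → Poly
    blockWeight A i Bᵢ = weight (admissible A i Bᵢ) ∣ Bᵢ ∣
    term : ∀ A B → weight (isIndependent P (A ++ B)) ∣ A ++ B ∣ ≐ (wA A *ₚ ∏ q (λ i → blockWeight A i (block q m B i)))
    term A B = begin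
      weight (isIndependent P (A ++ B)) ∣ A ++ B ∣
        ≡⟨ ≡.cong₂ weight (isIndependent-product A B) (size-++ A B) ⟩
      weight (admissiblePair A B) (∣ A ∣ ℕ.+ ∣ B ∣)
        ≈⟨ weight-∧ (isIndependent G A) (∀ᵇ q (λ i → admissible A i (block q m B i))) ∣ A ∣ ∣ B ∣ ⟩
      wA A *ₚ weight (∀ᵇ q (λ i → admissible A i (block q m B i))) ∣ B ∣
        ≈⟨ *ₚ-congˡ (wA A) (∏-weight q m (admissible A) B) ⟨
      wA A *ₚ ∏ q (λ i → blockWeight A i (block q m B i)) ∎

  q∸α : ℕ
  q∸α = q ∸ alpha G

  -- An independent set of G meets at most |A| ≤ α(G) cliques, so it avoids at least q − α(G).
  avoided-bound : ∀ A → isIndependent G A ≡ true → q∸α ≤ avoided A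
  avoided-bound A indep = ℕP.≤-trans (ℕP.∸-monoʳ-≤ q met≤α) (ℕP.≤-reflexive q∸met≡avoided)
    where
    met≤α : met A ≤ alpha G
    met≤α = ℕP.≤-trans (classes-met-bound n q (cls C) A) (alpha-bound G A indep)
    q∸met≡avoided : q ∸ met A ≡ avoided A
    q∸met≡avoided = ≡.trans (cong (_∸ met A) (≡.sym (trues-not q (λ i → avoids (cls C) i A))))
                            (ℕP.m+n∸n≡m (avoided A) (met A))

  cofactorTerm : Subset n → Poly
  cofactorTerm A = weight (isIndependent G A) ∣ A ∣ *ₚ ((indepPoly H ^ₚ (avoided A ∸ q∸α)) *ₚ (I[H-U] ^ₚ met A))

  factor-term : ∀ A → (weight (isIndependent G A) ∣ A ∣ *ₚ ((indepPoly H ^ₚ avoided A) *ₚ (I[H-U] ^ₚ met A)))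
                      ≐ ((indepPoly H ^ₚ q∸α) *ₚ cofactorTerm A)
  factor-term A with isIndependent G A in indep
  ... | false = sym (zeroʳ (indepPoly H ^ₚ q∸α))
  ... | true  = extract-power (avoided-bound A indep) (xPow ∣ A ∣) (indepPoly H) (I[H-U] ^ₚ met A)

  factorization : indepPoly P ≐ ((indepPoly H ^ₚ q∸α) *ₚ Σ⊆ n cofactorTerm)
  factorization = begin
    indepPoly P
      ≈⟨ indepPoly-expansion ⟩
    Σ⊆ n (λ A → weight (isIndependent G A) ∣ A ∣ *ₚ ((indepPoly H ^ₚ avoided A) *ₚ (I[H-U] ^ₚ met A)))
      ≈⟨ Σ⊆-cong n factor-term ⟩
    Σ⊆ n (λ A → (indepPoly H ^ₚ q∸α) *ₚ cofactorTerm A)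
      ≈⟨ *-distribˡ-Σ⊆ n (indepPoly H ^ₚ q∸α) cofactorTerm ⟩
    (indepPoly H ^ₚ q∸α) *ₚ Σ⊆ n cofactorTerm ∎

corollary1p2 : (G H : Graph) → IsSimple G → IsSimple H →
    (q : ℕ) (C : CliqueCover G q) (U : Subset (order H)) →
    (indepPoly H ^ₚ (q ∸ alpha G)) ∣ₚ indepPoly (cliqueCoverProduct G C H U)
corollary1p2 G H _ _ q C U = Σ⊆ (order G) cofactorTerm , λ k → ≡.sym (coeff-≡ factorization k)
  where open CliqueCoverProduct G C H U
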